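{- For all natural numbers $m,p,q$: $\models\mathit{Plus}(S^m(0),S^p(\tilde0),S^q(0))$ iff $q=m+p$.
   Context: First-order predicate calculus with identity $\doteq$ over a language with countably infinitely many function and predicate symbols of every arity; $\models\theta$ means $\theta$ is true in every structure. The language contains distinct constants $0,\tilde0$ and a unary function symbol $S$; $S^0(t)=t$, $S^{m+1}(t)=S(S^m(t))$. $\mathit{Plus}(x,y,z)$ is the semiformula $\tilde0\doteq x\to z\doteq y$. -}

module Defs where

open import Data.Nat using (ℕ; zero; suc)
open import Data.Nat.Properties using (_≟_)
open import Data.Vec using (Vec; []; _∷_)
open import Data.Empty using (⊥)
open import Relation.Binary.PropositionalEquality using (_≡_)
open import Relation.Nullary using (yes; no)

data Term : Set where
  var : ℕ → Term
  app : (i n : ℕ) → Vec Term n → Term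

data Formula : Set where
  _≐_ : Term → Term → Formula
  pred : (i n : ℕ) → Vec Term n → Formula
  ⊥f   : Formula
  _⇒_  : Formula → Formula → Formula
  ∀f   : ℕ → Formula → Formula

infix 6 _≐_
infixr 5 _⇒_

-- Structures (nonempty domain); identity is interpreted as true identity.
record Structure : Set₁ where
  field
    Dom  : Set
    elt  : Dom
    fun  : (i n : ℕ) → Vec Dom n → Dom
    rel  : (i n : ℕ) → Vec Dom n → Set

open Structure public

Assignment : Structure → Set
Assignment M = ℕ → Dom M

update : (M : Structure) → Assignment M → ℕ → Dom M → Assignment M
update M ρ x d y with y ≟ x
... | yes _ = d
... | no  _ = ρ y

mutual
  evalT : (M : Structure) → Assignment M → Term → Dom M
  evalT M ρ (var x) = ρ x
  evalT M ρ (app i n ts) = fun M i n (evalV M ρ ts)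

  evalV : (M : Structure) → Assignment M → ∀ {n} → Vec Term n → Vec (Dom M) n
  evalV M ρ [] = []
  evalV M ρ (t ∷ ts) = evalT M ρ t ∷ evalV M ρ ts

Sat : (M : Structure) → Assignment M → Formula → Set
Sat M ρ (s ≐ t) = evalT M ρ s ≡ evalT M ρ t
Sat M ρ (pred i n ts) = rel M i n (evalV M ρ ts)
Sat M ρ ⊥f = ⊥
Sat M ρ (φ ⇒ ψ) = Sat M ρ φ → Sat M ρ ψ
Sat M ρ (∀f x φ) = (d : Dom M) → Sat M (update M ρ x d) φ

⊨_ : Formula → Set₁
⊨ θ = (M : Structure) (ρ : Assignment M) → Sat M ρ θ

𝟎 : Term
𝟎 = app 0 0 []

𝟎̃ : Term
𝟎̃ = app 1 0 []

S : Term → Term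
S t = app 0 1 (t ∷ [])

S^ : ℕ → Term → Term
S^ zero t = t
S^ (suc m) t = S (S^ m t)

Plus : Term → Term → Term → Formula
Plus x y z = (𝟎̃ ≐ x) ⇒ (z ≐ y)

module Submission where

-- Write ⟦t⟧ for the value of a term t in a structure.
-- (⇐) The numeral S^(m+p)(t) is syntactically S^p(S^m(t)), and the value of
--     S^p(u) depends only on ⟦u⟧.  Hence in any structure where ⟦0̃⟧ = ⟦S^m(0)⟧
--     we get ⟦S^(m+p)(0)⟧ = ⟦S^p(S^m(0))⟧ = ⟦S^p(0̃)⟧, which is Plus for q = m+p.
-- (⇒) Evaluate the valid formula in the standard model of numerals on ℕ, with
--     0 ↦ 0, S ↦ suc and 0̃ ↦ m.  There ⟦S^n(t)⟧ = n + ⟦t⟧, so the premise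
--     0̃ ≐ S^m(0) holds and the conclusion reads q = p + m.

open import Defs
open import Data.Nat using (ℕ; zero; suc; _+_)
open import Data.Nat.Properties using (+-comm; +-identityʳ)
open import Data.Product using (_×_; _,_)
open import Data.Vec using (Vec; []; _∷_)
open import Relation.Binary.PropositionalEquality
  using (_≡_; refl; sym; trans; cong; module ≡-Reasoning)

S^-+ : (a b : ℕ) (t : Term) → S^ (a + b) t ≡ S^ a (S^ b t)
S^-+ zero    b t = refl
S^-+ (suc a) b t = cong S (S^-+ a b t)

evalT-S^-cong : (M : Structure) (ρ : Assignment M) (n : ℕ) {u v : Term} →
  evalT M ρ u ≡ evalT M ρ v → evalT M ρ (S^ n u) ≡ evalT M ρ (S^ n v)
evalT-S^-cong M ρ zero    u≡v = u≡v
evalT-S^-cong M ρ (suc n) u≡v =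
  cong (λ d → fun M 0 1 (d ∷ [])) (evalT-S^-cong M ρ n u≡v)

Plus-valid : (m p : ℕ) → ⊨ Plus (S^ m 𝟎) (S^ p 𝟎̃) (S^ (m + p) 𝟎)
Plus-valid m p M ρ 0̃≡Sᵐ0 = begin
  evalT M ρ (S^ (m + p) 𝟎)  ≡⟨ cong (λ k → evalT M ρ (S^ k 𝟎)) (+-comm m p) ⟩
  evalT M ρ (S^ (p + m) 𝟎)  ≡⟨ cong (evalT M ρ) (S^-+ p m 𝟎) ⟩
  evalT M ρ (S^ p (S^ m 𝟎)) ≡⟨ evalT-S^-cong M ρ p (sym 0̃≡Sᵐ0) ⟩
  evalT M ρ (S^ p 𝟎̃)        ∎
  where open ≡-Reasoning

ℕ-model : ℕ → Structure
ℕ-model c = record { Dom = ℕ ; elt = 0 ; fun = interp ; rel = λ _ _ _ → ℕ }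
  where
  interp : (i n : ℕ) → Vec ℕ n → ℕ
  interp 0 0 []       = 0
  interp 0 1 (x ∷ []) = suc x
  interp 1 0 []       = c
  interp _ _ _        = 0

ℕ-model-S^ : (c : ℕ) (ρ : Assignment (ℕ-model c)) (n : ℕ) (t : Term) →
  evalT (ℕ-model c) ρ (S^ n t) ≡ n + evalT (ℕ-model c) ρ t
ℕ-model-S^ c ρ zero    t = refl
ℕ-model-S^ c ρ (suc n) t = cong suc (ℕ-model-S^ c ρ n t)

Plus-valid⇒sum : (m p q : ℕ) →
  ⊨ Plus (S^ m 𝟎) (S^ p 𝟎̃) (S^ q 𝟎) → q ≡ m + p
Plus-valid⇒sum m p q valid = begin
  q                          ≡⟨ sym (+-identityʳ q) ⟩
  q + 0                      ≡⟨ sym (ℕ-model-S^ m ρ q 𝟎) ⟩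
  evalT M ρ (S^ q 𝟎)         ≡⟨ valid M ρ 0̃≡Sᵐ0 ⟩
  evalT M ρ (S^ p 𝟎̃)        ≡⟨ ℕ-model-S^ m ρ p 𝟎̃ ⟩
  p + m                      ≡⟨ +-comm p m ⟩
  m + p                      ∎
  where
  open ≡-Reasoning
  M = ℕ-model m
  ρ : Assignment M
  ρ _ = 0
  0̃≡Sᵐ0 : m ≡ evalT M ρ (S^ m 𝟎)
  0̃≡Sᵐ0 = sym (trans (ℕ-model-S^ m ρ m 𝟎) (+-identityʳ m))

lemma5p8 : (m p q : ℕ) →
    ((⊨ Plus (S^ m 𝟎) (S^ p 𝟎̃) (S^ q 𝟎)) → q ≡ m + p) ×
    (q ≡ m + p → ⊨ Plus (S^ m 𝟎) (S^ p 𝟎̃) (S^ q 𝟎))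
lemma5p8 m p q = Plus-valid⇒sum m p q , λ { refl → Plus-valid m p }
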